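{- Let $S\subseteq\mathbb{F}_2^n$ be a powerful set and let $\mathbf{v}\in S$ be a nonzero vector. Define $S+\Box\setminus\mathbf{v}\subseteq\mathbb{F}_2^{n+1}$ by \[S+\Box\setminus\mathbf{v}:=\{\mathbf{0}0,\ \mathbf{v}0\}\cup\{\mathbf{u}1\mid \mathbf{u}\in S\setminus\{\mathbf{0},\mathbf{v}\}\},\] where $\mathbf{u}a$ denotes the vector of length $n+1$ obtained by appending the bit $a$ to $\mathbf{u}$. Then $S+\Box\setminus\mathbf{v}$ is a powerful set.
   Context: A set $S\subseteq\mathbb{F}_2^n$ (positions indexed by $[n]=\{1,\dots,n\}$) is called a powerful set if for every $X\subseteq[n]$ the number of vectors in $S$ whose coordinates in all positions of $X$ are zero is a power of $2$. -}

module Defs where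

open import Data.Bool using (Bool; true; false; _∧_; not)
open import Data.Bool.Properties using () renaming (_≟_ to _≟B_)
open import Data.Nat using (ℕ; _^_)
open import Data.Fin using (Fin)
open import Data.Fin.Subset using (Subset)
open import Data.Vec using (Vec; replicate; _∷ʳ_; lookup)
open import Data.Vec.Properties using (≡-dec)
open import Data.List using (List; []; _∷_; length; filter; map)
open import Data.List.Relation.Unary.Unique.Propositional using (Unique)
open import Data.List.Membership.Propositional using (_∈_)
open import Data.Product using (∃)
open import Relation.Binary.PropositionalEquality using (_≡_)
open import Relation.Nullary using (¬_; Dec; yes; no)
open import Relation.Nullary.Decidable using (_×-dec_; ¬?)
open import Relation.Binary using (DecidableEquality)

-- Vectors in F_2^n, encoded as bit vectors (false = 0, true = 1).
𝔽₂^ : ℕ → Set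
𝔽₂^ n = Vec Bool n

record FinSet (n : ℕ) : Set where
  constructor finSet
  field
    elems  : List (𝔽₂^ n)
    unique : Unique elems
open FinSet public

_≟V_ : ∀ {n} → DecidableEquality (𝔽₂^ n)
_≟V_ = ≡-dec _≟B_

𝟎 : ∀ {n} → 𝔽₂^ n
𝟎 {n} = replicate n false

zeroOn : ∀ {n} → Subset n → 𝔽₂^ n → Set
zeroOn X u = ∀ i → lookup X i ≡ true → lookup u i ≡ false

zeroOn? : ∀ {n} (X : Subset n) (u : 𝔽₂^ n) → Dec (zeroOn X u)
zeroOn? {n} X u = Data.Fin.Properties.all? λ i → dec i
  where
  open import Data.Fin.Properties using (all?)
  dec : ∀ i → Dec (lookup X i ≡ true → lookup u i ≡ false)
  dec i with lookup X i ≟B true | lookup u i ≟B false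
  ... | _ | yes q = yes (λ _ → q)
  ... | no p | no _ = yes (λ e → Data.Empty.⊥-elim (p e))
    where import Data.Empty
  ... | yes p | no q = no (λ f → q (f p))

count : ∀ {n} → FinSet n → Subset n → ℕ
count S X = length (filter (zeroOn? X) (elems S))

IsPowerOf2 : ℕ → Set
IsPowerOf2 m = ∃ λ k → m ≡ 2 ^ k

Powerful : ∀ {n} → FinSet n → Set
Powerful {n} S = (X : Subset n) → IsPowerOf2 (count S X)

boxList : ∀ {n} → FinSet n → 𝔽₂^ n → List (𝔽₂^ (Data.Nat.suc n))
boxList S v =
  (𝟎 ∷ʳ false) ∷ (v ∷ʳ false) ∷
  map (_∷ʳ true) (filter (λ u → ¬? (u ≟V 𝟎) ×-dec ¬? (u ≟V v)) (elems S))

module Submission where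

open import Defs
open import Data.Nat using (ℕ; _<_)
open import Data.Nat.Properties using (m^n>0)
open import Data.Bool using (Bool; true; false)
open import Data.Fin using (zero; suc)
open import Data.Fin.Subset using (Subset)
open import Data.Vec using ([]; _∷_; _∷ʳ_; replicate; initLast)
open import Data.Vec.Properties using (lookup-replicate; ∷ʳ-injectiveˡ; ∷ʳ-injectiveʳ)
open import Data.List using (List; []; _∷_; _++_; length; filter; map)
open import Data.List.Properties
  using (filter-accept; filter-reject; filter-all; filter-none; filter-++; ++-identityʳ)
open import Data.List.Membership.Propositional using (_∈_)
open import Data.List.Membership.Propositional.Properties using (∈-filter⁺)
open import Data.List.Relation.Unary.All as All using (All; _∷_)
import Data.List.Relation.Unary.All.Properties as Allₚ
open import Data.List.Relation.Unary.Any using (here; there)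
open import Data.List.Relation.Unary.AllPairs using (_∷_)
open import Data.List.Relation.Unary.Unique.Propositional using (Unique)
import Data.List.Relation.Unary.Unique.Propositional.Properties as Unique
open import Data.List.Relation.Binary.Pointwise as Pointwise
  using (Pointwise; []; _∷_; Pointwise-length)
open import Data.List.Relation.Binary.Permutation.Propositional
  using (_↭_; prep; swap; ↭-refl; ↭-reflexive; ↭-trans; module PermutationReasoning)
open import Data.List.Relation.Binary.Permutation.Propositional.Properties using (filter-↭; ↭-length)
open import Data.Product using (Σ; ∃; _×_; _,_; proj₁; proj₂)
open import Function using (_∘_)
open import Function.Bundles using (_⇔_; mk⇔; Equivalence)
open import Relation.Binary using (DecidableEquality)
open import Relation.Binary.PropositionalEquality
  using (_≡_; _≢_; refl; sym; trans; cong; cong₂; subst; ≢-sym; module ≡-Reasoning)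
open import Relation.Nullary using (¬_; yes; no)
open import Relation.Nullary.Decidable using (_×-dec_; ¬?)
open import Relation.Unary using (Pred; Decidable)

-- Write X ⊆ [n+1] as X′ ⊆ [n] plus possibly the new position. If the new position is not in X,
-- the appended bit is irrelevant, and 𝟎0, v0 and the u1 vanish on X exactly when 𝟎, v and the
-- u ∈ S ∖ {𝟎, v} vanish on X′; since 𝟎 ∈ S (only 𝟎 vanishes on all of [n], and that count is a
-- power of 2, hence positive) this gives the count of S on X′. If the new position is in X, only
-- 𝟎0 and possibly v0 vanish on X, so the count is 1 or 2.

module _ {A : Set} {p q} {P : Pred A p} {Q : Pred A q} (P? : Decidable P) (Q? : Decidable Q) where

  filter-filter : ∀ xs → filter Q? (filter P? xs) ≡ filter (λ x → P? x ×-dec Q? x) xs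
  filter-filter [] = refl
  filter-filter (x ∷ xs) with P? x
  ... | no _ = filter-filter xs
  ... | yes _ with Q? x
  ...   | yes _ = cong (x ∷_) (filter-filter xs)
  ...   | no _ = filter-filter xs

module _ {A : Set} {p} {P : Pred A p} (P? : Decidable P) where

  ∃-∈-filter : ∀ xs → 0 < length (filter P? xs) → ∃ λ x → x ∈ xs × P x
  ∃-∈-filter (x ∷ xs) nonempty with P? x
  ... | yes px = x , here refl , px
  ... | no _ with y , y∈xs , py ← ∃-∈-filter xs nonempty = y , there y∈xs , py

module _ {A B : Set} {p q} {P : Pred A p} {Q : Pred B q} (P? : Decidable P) (Q? : Decidable Q) where

  length-filter-⇔ : ∀ {xs ys} → Pointwise (λ x y → P x ⇔ Q y) xs ys →
    length (filter P? xs) ≡ length (filter Q? ys)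
  length-filter-⇔ = Pointwise-length ∘ Pointwise.filter⁺ P? Q? Equivalence.to Equivalence.from

module _ {A : Set} (_≟_ : DecidableEquality A) where

  ↭-∷-filter-≢ : ∀ {a xs} → Unique xs → a ∈ xs → xs ↭ a ∷ filter (λ x → ¬? (x ≟ a)) xs
  ↭-∷-filter-≢ {a} {a ∷ xs} (a∉xs ∷ _) (here refl) = prep a (↭-reflexive (sym (begin
    filter (λ x → ¬? (x ≟ a)) (a ∷ xs)  ≡⟨ filter-reject (λ x → ¬? (x ≟ a)) (λ a≢a → a≢a refl) ⟩
    filter (λ x → ¬? (x ≟ a)) xs        ≡⟨ filter-all (λ x → ¬? (x ≟ a)) (All.map ≢-sym a∉xs) ⟩
    xs                                  ∎)))
    where open ≡-Reasoning
  ↭-∷-filter-≢ {a} {x ∷ xs} (x∉xs ∷ xs-unique) (there a∈xs) =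
    subst (λ ys → x ∷ xs ↭ a ∷ ys) (sym (filter-accept (λ y → ¬? (y ≟ a)) (All.lookup x∉xs a∈xs)))
      (↭-trans (prep x (↭-∷-filter-≢ xs-unique a∈xs)) (swap x a ↭-refl))

zeroOn-∷ʳ : ∀ {n} (X u : 𝔽₂^ n) {b a : Bool} →
  zeroOn (X ∷ʳ b) (u ∷ʳ a) ⇔ (zeroOn X u × (b ≡ true → a ≡ false))
zeroOn-∷ʳ [] [] = mk⇔ (λ h → (λ ()) , h zero) (λ { (_ , h) zero → h })
zeroOn-∷ʳ (x ∷ X) (y ∷ u) = mk⇔
  (λ h → (λ { zero → h zero ; (suc i) → proj₁ (to (h ∘ suc)) i }) , proj₂ (to (h ∘ suc)))
  (λ { (h , bit) zero → h zero ; (h , bit) (suc i) → from (h ∘ suc , bit) i })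
  where open Equivalence (zeroOn-∷ʳ X u)

zeroOn-∷ʳfalse-∷ʳ : ∀ {n} (X u : 𝔽₂^ n) {a} → zeroOn (X ∷ʳ false) (u ∷ʳ a) ⇔ zeroOn X u
zeroOn-∷ʳfalse-∷ʳ X u = mk⇔ (proj₁ ∘ to) (λ h → from (h , λ ()))
  where open Equivalence (zeroOn-∷ʳ X u)

zeroOn-∷ʳ-∷ʳfalse : ∀ {n} (X u : 𝔽₂^ n) {b} → zeroOn (X ∷ʳ b) (u ∷ʳ false) ⇔ zeroOn X u
zeroOn-∷ʳ-∷ʳfalse X u = mk⇔ (proj₁ ∘ to) (λ h → from (h , λ _ → refl))
  where open Equivalence (zeroOn-∷ʳ X u)

¬zeroOn-∷ʳtrue-∷ʳtrue : ∀ {n} (X u : 𝔽₂^ n) → ¬ zeroOn (X ∷ʳ true) (u ∷ʳ true)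
¬zeroOn-∷ʳtrue-∷ʳtrue X u h with () ← proj₂ (Equivalence.to (zeroOn-∷ʳ X u) h) refl

zeroOn-𝟎 : ∀ {n} (X : Subset n) → zeroOn X 𝟎
zeroOn-𝟎 X i _ = lookup-replicate i false

zeroOn-full⇒≡𝟎 : ∀ {n} {u : 𝔽₂^ n} → zeroOn (replicate n true) u → u ≡ 𝟎
zeroOn-full⇒≡𝟎 {u = []} _ = refl
zeroOn-full⇒≡𝟎 {u = y ∷ u} h = cong₂ _∷_ (h zero refl) (zeroOn-full⇒≡𝟎 (h ∘ suc))

countIn : ∀ {n} → List (𝔽₂^ n) → Subset n → ℕ
countIn xs X = length (filter (zeroOn? X) xs)

countIn-𝟎∷u∷[]-isPowerOf2 : ∀ {n} (X : Subset n) u → IsPowerOf2 (countIn (𝟎 ∷ u ∷ []) X)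
countIn-𝟎∷u∷[]-isPowerOf2 X u with zeroOn? X u
... | yes Xu = 1 , cong length (trans (filter-accept Z? (zeroOn-𝟎 X)) (cong (𝟎 ∷_) (filter-accept Z? Xu)))
  where Z? = zeroOn? X
... | no ¬Xu = 0 , cong length (trans (filter-accept Z? (zeroOn-𝟎 X)) (cong (𝟎 ∷_) (filter-reject Z? ¬Xu)))
  where Z? = zeroOn? X

𝟎∈-powerful : ∀ {n} (S : FinSet n) → Powerful S → 𝟎 ∈ elems S
𝟎∈-powerful {n} S powerful =
  let k , count≡2^k = powerful full
      u , u∈S , zero-u = ∃-∈-filter (zeroOn? full) (elems S) (subst (0 <_) (sym count≡2^k) (m^n>0 2 k))
  in subst (_∈ elems S) (zeroOn-full⇒≡𝟎 zero-u) u∈S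
  where full = replicate n true

module _ {n} (S : FinSet n) (v : 𝔽₂^ n) where

  others : List (𝔽₂^ n)
  others = filter (λ u → ¬? (u ≟V 𝟎) ×-dec ¬? (u ≟V v)) (elems S)

  boxList-unique : v ≢ 𝟎 → Unique (boxList S v)
  boxList-unique v≢𝟎 =
      ((λ eq → v≢𝟎 (sym (∷ʳ-injectiveˡ 𝟎 v eq))) ∷ ≢-ones 𝟎)
    ∷ ≢-ones v
    ∷ Unique.map⁺ (∷ʳ-injectiveˡ _ _) (Unique.filter⁺ _ (unique S))
    where
    false≢true : false ≢ true
    false≢true ()
    ≢-ones : ∀ w → All (w ∷ʳ false ≢_) (map (_∷ʳ true) others)
    ≢-ones w = Allₚ.map⁺ (All.universal (λ u eq → false≢true (∷ʳ-injectiveʳ w u eq)) others)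

  elems-↭ : 𝟎 ∈ elems S → v ∈ elems S → v ≢ 𝟎 → elems S ↭ 𝟎 ∷ v ∷ others
  elems-↭ 𝟎∈S v∈S v≢𝟎 = begin
    elems S                     ↭⟨ ↭-∷-filter-≢ _≟V_ (unique S) 𝟎∈S ⟩
    𝟎 ∷ nonzero                 ↭⟨ prep 𝟎 (↭-∷-filter-≢ _≟V_ nonzero-unique v∈nonzero) ⟩
    𝟎 ∷ v ∷ filter ≢v? nonzero  ≡⟨ cong (λ us → 𝟎 ∷ v ∷ us) (filter-filter ≢𝟎? ≢v? (elems S)) ⟩
    𝟎 ∷ v ∷ others              ∎
    where
    open PermutationReasoning
    ≢𝟎? = λ u → ¬? (u ≟V 𝟎)
    ≢v? = λ u → ¬? (u ≟V v)
    nonzero = filter ≢𝟎? (elems S)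
    nonzero-unique : Unique nonzero
    nonzero-unique = Unique.filter⁺ ≢𝟎? (unique S)
    v∈nonzero : v ∈ nonzero
    v∈nonzero = ∈-filter⁺ ≢𝟎? v∈S v≢𝟎

  countIn-boxList-∷ʳfalse : ∀ X → countIn (boxList S v) (X ∷ʳ false) ≡ countIn (𝟎 ∷ v ∷ others) X
  countIn-boxList-∷ʳfalse X = length-filter-⇔ (zeroOn? (X ∷ʳ false)) (zeroOn? X) {boxList S v}
    (zeroOn-∷ʳfalse-∷ʳ X 𝟎 ∷ zeroOn-∷ʳfalse-∷ʳ X v ∷ ones others)
    where
    ones : ∀ us → Pointwise (λ w u → zeroOn (X ∷ʳ false) w ⇔ zeroOn X u) (map (_∷ʳ true) us) us
    ones [] = []
    ones (u ∷ us) = zeroOn-∷ʳfalse-∷ʳ X u ∷ ones us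

  countIn-boxList-∷ʳtrue : ∀ X → countIn (boxList S v) (X ∷ʳ true) ≡ countIn (𝟎 ∷ v ∷ []) X
  countIn-boxList-∷ʳtrue X = begin
    length (filter Z? (pair ++ ones))          ≡⟨ cong length (filter-++ Z? pair ones) ⟩
    length (filter Z? pair ++ filter Z? ones)  ≡⟨ cong (λ ys → length (filter Z? pair ++ ys)) ones-rejected ⟩
    length (filter Z? pair ++ [])              ≡⟨ cong length (++-identityʳ (filter Z? pair)) ⟩
    length (filter Z? pair)                    ≡⟨ length-filter-⇔ Z? (zeroOn? X) {pair} pair-related ⟩
    countIn (𝟎 ∷ v ∷ []) X                     ∎
    where
    open ≡-Reasoning
    Z? = zeroOn? (X ∷ʳ true)
    pair = (𝟎 ∷ʳ false) ∷ (v ∷ʳ false) ∷ []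
    ones = map (_∷ʳ true) others
    ones-rejected : filter Z? ones ≡ []
    ones-rejected = filter-none Z? (Allₚ.map⁺ (All.universal (¬zeroOn-∷ʳtrue-∷ʳtrue X) others))
    pair-related : Pointwise (λ w u → zeroOn (X ∷ʳ true) w ⇔ zeroOn X u) pair (𝟎 ∷ v ∷ [])
    pair-related = zeroOn-∷ʳ-∷ʳfalse X 𝟎 ∷ zeroOn-∷ʳ-∷ʳfalse X v ∷ []

theorem5 : (n : ℕ) (S : FinSet n) (v : 𝔽₂^ n) →
    Powerful S → v ∈ elems S → v ≢ 𝟎 →
    Σ (Unique (boxList S v)) (λ u → Powerful (finSet (boxList S v) u))
theorem5 n S v powerful v∈S v≢𝟎 = boxList-unique S v v≢𝟎 , box-powerful
  where
  S↭𝟎∷v∷others : elems S ↭ 𝟎 ∷ v ∷ others S v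
  S↭𝟎∷v∷others = elems-↭ S v (𝟎∈-powerful S powerful) v∈S v≢𝟎

  box-powerful : Powerful (finSet (boxList S v) (boxList-unique S v v≢𝟎))
  box-powerful X with initLast X
  ... | X′ , false , refl = subst IsPowerOf2 (sym (begin
    countIn (boxList S v) (X′ ∷ʳ false)  ≡⟨ countIn-boxList-∷ʳfalse S v X′ ⟩
    countIn (𝟎 ∷ v ∷ others S v) X′      ≡⟨ ↭-length (filter-↭ (zeroOn? X′) S↭𝟎∷v∷others) ⟨
    count S X′                           ∎)) (powerful X′)
    where open ≡-Reasoning
  ... | X′ , true , refl =
    subst IsPowerOf2 (sym (countIn-boxList-∷ʳtrue S v X′)) (countIn-𝟎∷u∷[]-isPowerOf2 X′ v)
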